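{- Let $X=(V,E)$ be a connected graph and $S\subseteq V$ (possibly empty), with $\overline{S}=V\setminus S$. Then: (i) $\operatorname{col}(I+R)\cap \ker(O_SD_t) = M\ker(B_{\overline{S}})$; (ii) $\operatorname{col}(I-R)\cap \ker(O_SD_t) = N\ker(C_{\overline{S}})$; (iii) $\operatorname{col}(I+R)\cap \operatorname{col}(D_t^TO_S)$ equals $\operatorname{span}\{\mathbf{1}\}$ if $S=\emptyset$, and $\{0\}$ if $S\neq\emptyset$; (iv) $\operatorname{col}(I-R)\cap \operatorname{col}(D_t^TO_S)$ equals $\operatorname{span}\{y\}$ if $S=\emptyset$ and $X$ is bipartite with bipartition $(V_1,V_2)$, where $y\in\mathbb{R}^{\text{arcs}}$ has $y_{(u,v)}=1$ if $u\in V_1,v\in V_2$ and $y_{(u,v)}=-1$ if $u\in V_2,v\in V_1$; and it equals $\{0\}$ if $S\neq\emptyset$ or $X$ is non-bipartite.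
   Context: An arc of $X$ is an ordered pair $(u,v)$ of adjacent vertices ($u$ the tail, $v$ the head). $R$ is the arc-reversal permutation matrix swapping $(u,v)$ and $(v,u)$. $D_t$ (resp. $D_h$) is the $V\times\text{arcs}$ matrix with $(D_t)_{a,(u,v)}=1$ iff $a=u$ (resp. $(D_h)_{a,(u,v)}=1$ iff $a=v$), and $0$ otherwise. $O_S$ is the $n\times n$ identity matrix with its $[S,S]$ block set to zero. $B$ is the (unsigned) vertex-edge incidence matrix and $M$ the arc-edge incidence matrix ($M_{(u,v),e}=1$ iff $e=\{u,v\}$). Fix an orientation of $X$; $C$ is the signed vertex-edge incidence matrix ($C_{u,e}=1$, $C_{v,e}=-1$ if $e$ is oriented $u\to v$) and $N$ the signed arc-edge incidence matrix ($N_{(u,v),e}=1$ if $e=\{u,v\}$ is oriented $u\to v$, $-1$ if oriented $v\to u$, $0$ otherwise). $B_{\overline{S}}$, $C_{\overline{S}}$ denote the submatrices of $B$, $C$ consisting of the rows indexed by $\overline{S}$. $\mathbf{1}$ is the all-ones vector on arcs. -}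

module Defs where

open import Level using (Level; _⊔_; Lift) renaming (suc to lsuc)
open import Data.Nat using (ℕ; zero; suc; _<ᵇ_)
open import Data.Bool using (Bool; true; false; T; _∧_; _∨_; not; if_then_else_)
open import Data.Unit using (tt)
open import Data.Fin using (Fin; toℕ; _≟_)
open import Data.Fin.Subset using (Subset; _∉_)
open import Data.Fin.Subset.Properties using (_∈?_)
open import Data.List using (List; []; _∷_; concatMap; foldr)
open import Data.List.Base using (allFin)
open import Data.Product using (Σ; ∃; _×_; _,_; proj₁; proj₂)
open import Relation.Nullary using (¬_)
open import Relation.Nullary.Decidable using (⌊_⌋)
open import Relation.Binary.PropositionalEquality using (_≡_; _≢_)
open import Algebra.Bundles using (CommutativeRing)

record Field (c ℓ : Level) : Set (lsuc (c ⊔ ℓ)) where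
  field
    commutativeRing : CommutativeRing c ℓ
  open CommutativeRing commutativeRing public
  field
    1≉0     : ¬ (1# ≈ 0#)
    inverse : ∀ x → ¬ (x ≈ 0#) → Σ Carrier (λ y → (x * y) ≈ 1#)

natF : ∀ {c ℓ} (F : Field c ℓ) → ℕ → Field.Carrier F
natF F zero    = Field.0# F
natF F (suc n) = Field._+_ F (Field.1# F) (natF F n)

CharZero : ∀ {c ℓ} (F : Field c ℓ) → Set ℓ
CharZero F = ∀ n → ¬ (Field._≈_ F (natF F (suc n)) (Field.0# F))

record Graph (n : ℕ) : Set where
  field
    adj        : Fin n → Fin n → Bool
    adj-sym    : ∀ u v → adj u v ≡ adj v u
    adj-irrefl : ∀ u → adj u u ≡ false

pick : ∀ {a} {A : Set a} (b : Bool) → (T b → A) → List A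
pick true  f = f tt ∷ []
pick false f = []

module GraphDefs {n : ℕ} (X : Graph n) where
  open Graph X public

  Pairs : (Fin n → Fin n → Bool) → Set
  Pairs P = Σ (Fin n × Fin n) (λ p → T (P (proj₁ p) (proj₂ p)))

  pairs : (P : Fin n → Fin n → Bool) → List (Pairs P)
  pairs P = concatMap (λ u → concatMap (λ v → pick (P u v) (λ t → ((u , v) , t))) (allFin n)) (allFin n)

  Arc : Set
  Arc = Pairs adj

  arcs : List Arc
  arcs = pairs adj

  tl hd : Arc → Fin n
  tl a = proj₁ (proj₁ a)
  hd a = proj₂ (proj₁ a)

  -- edges: represented by their endpoint pair {u , v} with u < v
  isEdge : Fin n → Fin n → Bool
  isEdge u v = adj u v ∧ (toℕ u <ᵇ toℕ v)

  Edge : Set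
  Edge = Pairs isEdge

  edges : List Edge
  edges = pairs isEdge

  end₁ end₂ : Edge → Fin n
  end₁ e = proj₁ (proj₁ e)
  end₂ e = proj₂ (proj₁ e)

  -- an orientation: o e = true means e is oriented end₁ → end₂,
  -- o e = false means it is oriented end₂ → end₁
  Orientation : Set
  Orientation = Edge → Bool

  etail ehead : Orientation → Edge → Fin n
  etail o e = if o e then end₁ e else end₂ e
  ehead o e = if o e then end₂ e else end₁ e

  data Walk : Fin n → Fin n → Set where
    here : ∀ {u} → Walk u u
    step : ∀ {u v w} → T (adj u v) → Walk v w → Walk u w

  Connected : Set
  Connected = ∀ u v → Walk u v

  -- proper 2-colourings; colour true = V₁, colour false = V₂
  Bipartition : (Fin n → Bool) → Set
  Bipartition c = ∀ u v → T (adj u v) → c u ≢ c v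

  Bipartite : Set
  Bipartite = Σ (Fin n → Bool) Bipartition

-- Linear algebra over a field F, with finite index types given by an
-- explicit enumeration list.

module LinAlg {c ℓ} (F : Field c ℓ) where
  open Field F

  δ : Bool → Carrier
  δ true  = 1#
  δ false = 0#

  sumL : ∀ {I : Set} → List I → (I → Carrier) → Carrier
  sumL is f = foldr (λ i acc → f i + acc) 0# is

  Matrix : Set → Set → Set c
  Matrix I J = I → J → Carrier

  app : ∀ {I J : Set} → List J → Matrix I J → (J → Carrier) → (I → Carrier)
  app js A x i = sumL js (λ j → A i j * x j)

  mul : ∀ {I J K : Set} → List J → Matrix I J → Matrix J K → Matrix I K
  mul js A B i k = sumL js (λ j → A i j * B j k)

  transpose : ∀ {I J : Set} → Matrix I J → Matrix J I
  transpose A j i = A i j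

  madd msub : ∀ {I J : Set} → Matrix I J → Matrix I J → Matrix I J
  madd A B i j = A i j + B i j
  msub A B i j = A i j - B i j

  rows : ∀ {I J : Set} (P : I → Set) → Matrix I J → Matrix (Σ I P) J
  rows P A ip j = A (proj₁ ip) j

  VSet : Set → Set _
  VSet I = (I → Carrier) → Set (c ⊔ ℓ)

  Col : ∀ {I J : Set} → List J → Matrix I J → VSet I
  Col js A y = Σ _ (λ x → ∀ i → app js A x i ≈ y i)

  Ker : ∀ {I J : Set} → List J → Matrix I J → VSet J
  Ker js A x = Lift c (∀ i → app js A x i ≈ 0#)

  Img : ∀ {I J : Set} → List J → Matrix I J → VSet J → VSet I
  Img js A W y = Σ _ (λ x → W x × (∀ i → app js A x i ≈ y i))

  _∩_ : ∀ {I : Set} → VSet I → VSet I → VSet I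
  (P ∩ Q) y = P y × Q y

  _≐_ : ∀ {I : Set} → VSet I → VSet I → Set _
  P ≐ Q = ∀ y → (P y → Q y) × (Q y → P y)

  span1 : ∀ {I : Set} → (I → Carrier) → VSet I
  span1 v y = Σ Carrier (λ t → ∀ i → y i ≈ t * v i)

  zeroSpace : ∀ {I : Set} → VSet I
  zeroSpace y = Lift c (∀ i → y i ≈ 0#)

module GraphMatrices {c ℓ} (F : Field c ℓ) {n : ℕ} (X : Graph n) (S : Subset n) where
  open Field F
  open LinAlg F public
  open GraphDefs X public

  _==_ : Fin n → Fin n → Bool
  u == v = ⌊ u ≟ v ⌋

  inS : Fin n → Bool
  inS u = ⌊ u ∈? S ⌋

  Sbar : Fin n → Set
  Sbar u = u ∉ S

  vertices : List (Fin n)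
  vertices = allFin n

  I : Matrix Arc Arc
  I a b = δ ((tl a == tl b) ∧ (hd a == hd b))

  R : Matrix Arc Arc
  R a b = δ ((tl a == hd b) ∧ (hd a == tl b))

  Dt : Matrix (Fin n) Arc
  Dt x a = δ (x == tl a)

  Dh : Matrix (Fin n) Arc
  Dh x a = δ (x == hd a)

  O : Matrix (Fin n) (Fin n)
  O x y = δ ((x == y) ∧ not (inS x))

  B : Matrix (Fin n) Edge
  B x e = δ ((x == end₁ e) ∨ (x == end₂ e))

  M : Matrix Arc Edge
  M a e = δ (((tl a == end₁ e) ∧ (hd a == end₂ e)) ∨ ((tl a == end₂ e) ∧ (hd a == end₁ e)))

  C : Orientation → Matrix (Fin n) Edge
  C o x e = if x == etail o e then 1# else (if x == ehead o e then - 1# else 0#)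

  N : Orientation → Matrix Arc Edge
  N o a e = if (tl a == etail o e) ∧ (hd a == ehead o e) then 1#
            else (if (tl a == ehead o e) ∧ (hd a == etail o e) then - 1# else 0#)

  B̄ : Matrix (Σ (Fin n) Sbar) Edge
  B̄ = rows Sbar B

  C̄ : Orientation → Matrix (Σ (Fin n) Sbar) Edge
  C̄ o = rows Sbar (C o)

  one : Arc → Carrier
  one a = 1#

  ybip : (Fin n → Bool) → Arc → Carrier
  ybip col a = if col (tl a) then 1# else - 1#

  I+R I-R : Matrix Arc Arc
  I+R = madd I R
  I-R = msub I R

  OSDt : Matrix (Fin n) Arc
  OSDt = mul vertices O Dt

  DtᵀOS : Matrix Arc (Fin n)
  DtᵀOS = mul vertices (transpose Dt) O

-- Write ε = 1 for I + R and ε = -1 for I - R. As 2 is invertible, col(I + εR) consists of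
-- the arc vectors with y(v,u) = ε y(u,v); these are the images under M (ε = 1) or N (ε = -1)
-- of their restrictions to edges, and summing over the arcs leaving a vertex turns
-- O_S D_t y = 0 into B̄ z = 0 or C̄ z = 0. A vector of col(D_tᵀ O_S) has the form
-- y(u,v) = f(u) with f vanishing on S, and ε-symmetry says f(v) = ε f(u) along every edge.
-- On a connected graph such an f vanishes identically as soon as it vanishes somewhere;
-- otherwise it is constant (ε = 1), a multiple of the ±1 colouring of a bipartition
-- (ε = -1), or zero because an odd closed walk forces f = -f (ε = -1, non-bipartite).

module Submission where

open import Defs
open import Level using (lift)
open import Data.Nat using (ℕ; zero; suc; _<_; _<ᵇ_)
import Data.Nat.Properties as ℕ
open import Data.Bool using (Bool; true; false; T; _∧_; _∨_; not; if_then_else_)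
import Data.Bool.Properties as Bool
open import Data.Unit using (tt)
open import Data.Empty using (⊥; ⊥-elim)
open import Data.Fin using (Fin; zero; suc; toℕ; punchIn) renaming (_≟_ to _≟ᶠ_)
import Data.Fin.Properties as Fin
open import Relation.Binary.Definitions using (tri<; tri≈; tri>)
open import Data.Fin.Subset using (Subset; _∈_; _∉_) renaming (⊥ to ∅)
open import Data.Fin.Subset.Properties using (_∈?_; nonempty?; Empty-unique; ∉⊥)
open import Data.List using (List; []; _∷_; _++_; concatMap; tabulate; allFin)
open import Data.Product using (Σ; _×_; _,_; proj₁; proj₂)
open import Data.Sum using (_⊎_; inj₁; inj₂)
open import Function using (_∘_; Equivalence)
open import Relation.Nullary using (¬_; Dec; yes; no)
open import Relation.Nullary.Decidable using (isYes≗does; dec-true; dec-false; toWitness; T?; ¬?; _→-dec_; decidable-stable)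
open import Relation.Binary.PropositionalEquality as ≡ using (_≡_; _≢_)

<ᵇ-false : ∀ m k → ¬ (m < k) → (m <ᵇ k) ≡ false
<ᵇ-false m k m≮k with m <ᵇ k in eq
... | true  = ⊥-elim (m≮k (ℕ.<ᵇ⇒< m k (≡.subst T (≡.sym eq) tt)))
... | false = ≡.refl

module Summation {c ℓ} (F : Field c ℓ) where
  open Field F hiding (zero)
  open LinAlg F
  open import Algebra.Properties.Semiring.Sum semiring public using (sum; sum-cong-≋; ∑-distrib-+; *-distribˡ-sum)
  open import Algebra.Properties.Semiring.Sum semiring using (sum-replicate-zero; sum-remove)
  open import Algebra.Properties.CommutativeSemigroup +-commutativeSemigroup
    using () renaming (interchange to +-interchange)
  open import Relation.Binary.Reasoning.Setoid setoid

  guard : (b : Bool) → (T b → Carrier) → Carrier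
  guard true  h = h tt
  guard false h = 0#

  guard-cong : ∀ b {h h′ : T b → Carrier} → (∀ t → h t ≈ h′ t) → guard b h ≈ guard b h′
  guard-cong true  h≈h′ = h≈h′ tt
  guard-cong false h≈h′ = refl

  guard-true : ∀ {b} (h : T b → Carrier) (t : T b) → guard b h ≈ h t
  guard-true {true} h tt = refl

  guard-false : ∀ {b} (h : T b → Carrier) → b ≡ false → guard b h ≈ 0#
  guard-false h ≡.refl = refl

  guard-≈ : ∀ b {h : T b → Carrier} {x} → (∀ t → h t ≈ x) → (b ≡ false → x ≈ 0#) → guard b h ≈ x
  guard-≈ true  h≈x _   = h≈x tt
  guard-≈ false _   x≈0 = sym (x≈0 ≡.refl)

  guard-*ˡ : ∀ b d (h : T b → Carrier) → guard b (λ t → d * h t) ≈ d * guard b h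
  guard-*ˡ true  d h = refl
  guard-*ˡ false d h = sym (zeroʳ d)

  sumL-cong : ∀ {A : Set} (xs : List A) {f g : A → Carrier} → (∀ i → f i ≈ g i) → sumL xs f ≈ sumL xs g
  sumL-cong []       f≈g = refl
  sumL-cong (x ∷ xs) f≈g = +-cong (f≈g x) (sumL-cong xs f≈g)

  sumL-+ : ∀ {A : Set} (xs : List A) (f g : A → Carrier) →
           sumL xs (λ i → f i + g i) ≈ sumL xs f + sumL xs g
  sumL-+ []       f g = sym (+-identityʳ 0#)
  sumL-+ (x ∷ xs) f g = trans (+-congˡ (sumL-+ xs f g)) (+-interchange _ _ _ _)

  sumL-*ˡ : ∀ {A : Set} (xs : List A) d (f : A → Carrier) → sumL xs (λ i → d * f i) ≈ d * sumL xs f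
  sumL-*ˡ []       d f = sym (zeroʳ d)
  sumL-*ˡ (x ∷ xs) d f = trans (+-congˡ (sumL-*ˡ xs d f)) (sym (distribˡ d _ _))

  sumL-++ : ∀ {A : Set} (xs ys : List A) (f : A → Carrier) → sumL (xs ++ ys) f ≈ sumL xs f + sumL ys f
  sumL-++ []       ys f = sym (+-identityˡ _)
  sumL-++ (x ∷ xs) ys f = trans (+-congˡ (sumL-++ xs ys f)) (sym (+-assoc _ _ _))

  sumL-concatMap : ∀ {A B : Set} (g : A → List B) (xs : List A) (f : B → Carrier) →
                   sumL (concatMap g xs) f ≈ sumL xs (λ x → sumL (g x) f)
  sumL-concatMap g []       f = refl
  sumL-concatMap g (x ∷ xs) f = trans (sumL-++ (g x) (concatMap g xs) f) (+-congˡ (sumL-concatMap g xs f))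

  sumL-tabulate : ∀ {A : Set} n (g : Fin n → A) (f : A → Carrier) → sumL (tabulate g) f ≡ sum (f ∘ g)
  sumL-tabulate zero    g f = ≡.refl
  sumL-tabulate (suc n) g f = ≡.cong (f (g zero) +_) (sumL-tabulate n (g ∘ suc) f)

  sumL-allFin : ∀ n (f : Fin n → Carrier) → sumL (allFin n) f ≡ sum f
  sumL-allFin n = sumL-tabulate n (λ i → i)

  sumL-pick : ∀ {A : Set} b (g : T b → A) (f : A → Carrier) → sumL (pick b g) f ≈ guard b (f ∘ g)
  sumL-pick true  g f = +-identityʳ _
  sumL-pick false g f = refl

  ∑-sift : ∀ {n} (k : Fin n) (f : Fin n → Carrier) → (∀ i → i ≢ k → f i ≈ 0#) → sum f ≈ f k
  ∑-sift {suc n} k f off-k = begin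
    sum f                            ≈⟨ sum-remove {i = k} f ⟩
    f k + sum (f ∘ punchIn k)        ≈⟨ +-congˡ (sum-cong-≋ (λ i → off-k _ (Fin.punchInᵢ≢i k i))) ⟩
    f k + sum {n} (λ _ → 0#)         ≈⟨ +-congˡ (sum-replicate-zero n) ⟩
    f k + 0#                         ≈⟨ +-identityʳ _ ⟩
    f k                              ∎

module Scalars {c ℓ} (F : Field c ℓ) where
  open Field F hiding (zero)
  open LinAlg F
  open import Algebra.Properties.Ring ring public using (-1*x≈-x; -‿distribˡ-*; -‿involutive)
  open import Algebra.Properties.CommutativeSemigroup *-commutativeSemigroup public
    using () renaming (x∙yz≈y∙xz to x*[y*z]≈y*[x*z])
  open import Relation.Binary.Reasoning.Setoid setoid

  δ-≡ : ∀ {p q} → p ≡ q → δ p ≈ δ q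
  δ-≡ p≡q = reflexive (≡.cong δ p≡q)

  δ-∧-* : ∀ p q x → δ (p ∧ q) * x ≈ δ p * (δ q * x)
  δ-∧-* true  q x = sym (*-identityˡ _)
  δ-∧-* false q x = sym (trans (zeroˡ _) (sym (zeroˡ x)))

  δ-∨-* : ∀ p q → (T p → T q → ⊥) → ∀ x → δ (p ∨ q) * x ≈ δ p * x + 1# * (δ q * x)
  δ-∨-* true  true  p≠q x = ⊥-elim (p≠q tt tt)
  δ-∨-* true  false p≠q x = sym (trans (+-congˡ (trans (*-identityˡ _) (zeroˡ x))) (+-identityʳ _))
  δ-∨-* false q     p≠q x = sym (trans (+-congʳ (zeroˡ x)) (trans (+-identityˡ _) (*-identityˡ _)))

  -1*-1≈1 : - 1# * - 1# ≈ 1#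
  -1*-1≈1 = trans (-1*x≈-x (- 1#)) (-‿involutive 1#)

  δ-ite-* : ∀ p q → (T p → T q → ⊥) → ∀ x →
            (if p then 1# else (if q then - 1# else 0#)) * x ≈ δ p * x + - 1# * (δ q * x)
  δ-ite-* true  true  p≠q x = ⊥-elim (p≠q tt tt)
  δ-ite-* true  false p≠q x = sym (trans (+-congˡ (trans (*-congˡ (zeroˡ x)) (zeroʳ _))) (+-identityʳ _))
  δ-ite-* false true  p≠q x = sym (trans (+-congʳ (zeroˡ x)) (trans (+-identityˡ _) (*-congˡ (*-identityˡ x))))
  δ-ite-* false false p≠q x =
    sym (trans (+-congʳ (zeroˡ x)) (trans (+-identityˡ _) (trans (*-congˡ (zeroˡ x)) (trans (zeroʳ _) (sym (zeroˡ x))))))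

  ε*[ε*x]≈x : ∀ {ε} → ε * ε ≈ 1# → ∀ x → ε * (ε * x) ≈ x
  ε*[ε*x]≈x {ε} ε²≈1 x = trans (sym (*-assoc ε ε x)) (trans (*-congʳ ε²≈1) (*-identityˡ x))

  -1*[-1*x]≈x : ∀ x → - 1# * (- 1# * x) ≈ x
  -1*[-1*x]≈x = ε*[ε*x]≈x -1*-1≈1

  ε-swap : ∀ {ε} → ε * ε ≈ 1# → ∀ x y → y + ε * x ≈ ε * (x + ε * y)
  ε-swap {ε} ε²≈1 x y = begin
    y + ε * x            ≈⟨ +-comm _ _ ⟩
    ε * x + y            ≈⟨ +-congˡ (ε*[ε*x]≈x ε²≈1 y) ⟨
    ε * x + ε * (ε * y)  ≈⟨ distribˡ ε _ _ ⟨
    ε * (x + ε * y)      ∎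

  module CharacteristicNotTwo (1+1≉0 : ¬ (1# + 1# ≈ 0#)) where

    half : Carrier
    half = proj₁ (inverse (1# + 1#) 1+1≉0)

    half+half : ∀ x → half * x + half * x ≈ x
    half+half x = begin
      half * x + half * x                ≈⟨ +-cong (*-identityˡ _) (*-identityˡ _) ⟨
      1# * (half * x) + 1# * (half * x)  ≈⟨ distribʳ _ 1# 1# ⟨
      (1# + 1#) * (half * x)             ≈⟨ *-assoc _ _ _ ⟨
      ((1# + 1#) * half) * x             ≈⟨ *-congʳ (proj₂ (inverse (1# + 1#) 1+1≉0)) ⟩
      1# * x                             ≈⟨ *-identityˡ x ⟩
      x                                  ∎

    x≈-1*x⇒x≈0 : ∀ {x} → x ≈ - 1# * x → x ≈ 0#
    x≈-1*x⇒x≈0 {x} x≈-x = begin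
      x                          ≈⟨ half+half x ⟨
      half * x + half * x        ≈⟨ distribˡ half x x ⟨
      half * (x + x)             ≈⟨ *-congˡ (+-congˡ (trans x≈-x (-1*x≈-x x))) ⟩
      half * (x - x)             ≈⟨ *-congˡ (-‿inverseʳ x) ⟩
      half * 0#                  ≈⟨ zeroʳ half ⟩
      0#                         ∎

  sign : Bool → Carrier
  sign b = if b then 1# else - 1#

  sign*sign : ∀ b → sign b * sign b ≈ 1#
  sign*sign true  = *-identityˡ 1#
  sign*sign false = -1*-1≈1

  sign-not : ∀ b → - 1# * sign b ≈ sign (not b)
  sign-not true  = *-identityʳ _
  sign-not false = -1*-1≈1

  sign-≢ : ∀ {b b′} → b ≢ b′ → sign b′ ≈ - 1# * sign b
  sign-≢ {true}  {true}  b≢b′ = ⊥-elim (b≢b′ ≡.refl)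
  sign-≢ {true}  {false} b≢b′ = sym (*-identityʳ _)
  sign-≢ {false} {true}  b≢b′ = sym -1*-1≈1
  sign-≢ {false} {false} b≢b′ = ⊥-elim (b≢b′ ≡.refl)

  [-1*x]*[-1*y]≈x*y : ∀ x y → (- 1# * x) * (- 1# * y) ≈ x * y
  [-1*x]*[-1*y]≈x*y x y = trans (*-assoc _ _ _) (trans (*-congˡ (x*[y*z]≈y*[x*z] x _ y)) (-1*[-1*x]≈x _))

  pairwise-≈⇒constant : ∀ {n} (g : Fin n → Carrier) → (∀ u v → g u ≈ g v) → Σ Carrier λ t → ∀ u → g u ≈ t
  pairwise-≈⇒constant {zero}  g _      = 0# , λ ()
  pairwise-≈⇒constant {suc n} g g-pair = g zero , λ u → g-pair u zero

module Incidence {c ℓ} (F : Field c ℓ) {n : ℕ} (X : Graph n) (S : Subset n) where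
  open Field F hiding (zero)
  open Summation F
  open Scalars F
  open GraphMatrices F X S
  open import Relation.Binary.Reasoning.Setoid setoid

  ==-refl : ∀ k → (k == k) ≡ true
  ==-refl k = ≡.trans (isYes≗does (k ≟ᶠ k)) (dec-true (k ≟ᶠ k) ≡.refl)

  ==-≢ : ∀ {i k} → i ≢ k → (i == k) ≡ false
  ==-≢ {i} {k} i≢k = ≡.trans (isYes≗does (i ≟ᶠ k)) (dec-false (i ≟ᶠ k) i≢k)

  ∑-cong : {f g : Fin n → Carrier} → (∀ i → f i ≈ g i) → sum f ≈ sum g
  ∑-cong = sum-cong-≋ {n}

  *-distribˡ-∑ : ∀ x (f : Fin n → Carrier) → x * sum f ≈ sum (λ i → x * f i)
  *-distribˡ-∑ = *-distribˡ-sum {n}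

  ∑-δˡ : ∀ k (f : Fin n → Carrier) → sum (λ i → δ (k == i) * f i) ≈ f k
  ∑-δˡ k f = trans (∑-sift k _ off-k) (trans (*-congʳ (δ-≡ (==-refl k))) (*-identityˡ _))
    where
    off-k : ∀ i → i ≢ k → δ (k == i) * f i ≈ 0#
    off-k i i≢k = trans (*-congʳ (δ-≡ (==-≢ (i≢k ∘ ≡.sym)))) (zeroˡ _)

  ∑-δʳ : ∀ k (f : Fin n → Carrier) → sum (λ i → δ (i == k) * f i) ≈ f k
  ∑-δʳ k f = trans (∑-sift k _ off-k) (trans (*-congʳ (δ-≡ (==-refl k))) (*-identityˡ _))
    where
    off-k : ∀ i → i ≢ k → δ (i == k) * f i ≈ 0#
    off-k i i≢k = trans (*-congʳ (δ-≡ (==-≢ i≢k))) (zeroˡ _)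

  extend : (P : Fin n → Fin n → Bool) → (Pairs P → Carrier) → Fin n → Fin n → Carrier
  extend P g u v = guard (P u v) (λ t → g ((u , v) , t))

  sumL-pairs : ∀ P (g : Pairs P → Carrier) → sumL (pairs P) g ≈ sum (λ u → sum (extend P g u))
  sumL-pairs P g = begin
    sumL (pairs P) g                                        ≈⟨ sumL-concatMap _ (allFin n) g ⟩
    sumL (allFin n) (λ u → sumL (row u) g)                  ≡⟨ sumL-allFin n _ ⟩
    sum (λ u → sumL (row u) g)                              ≈⟨ ∑-cong (λ u → sumL-concatMap _ (allFin n) g) ⟩
    sum (λ u → sumL (allFin n) (λ v → sumL (entry u v) g))  ≈⟨ ∑-cong (λ u → reflexive (sumL-allFin n _)) ⟩
    sum (λ u → sum (λ v → sumL (entry u v) g))              ≈⟨ ∑-cong (λ u → ∑-cong (λ v → sumL-pick (P u v) _ g)) ⟩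
    sum (λ u → sum (extend P g u))                          ∎
    where
    entry : ∀ u v → List (Pairs P)
    entry u v = pick (P u v) (λ t → ((u , v) , t))
    row : Fin n → List (Pairs P)
    row u = concatMap (entry u) (allFin n)

  sumL-pairs-weighted : ∀ P (d : Fin n → Fin n → Carrier) (g : Pairs P → Carrier) →
    sumL (pairs P) (λ b → d (proj₁ (proj₁ b)) (proj₂ (proj₁ b)) * g b)
      ≈ sum (λ u → sum (λ v → d u v * extend P g u v))
  sumL-pairs-weighted P d g =
    trans (sumL-pairs P _) (∑-cong λ u → ∑-cong λ v → guard-*ˡ (P u v) (d u v) _)

  sumL-pairs-at : ∀ P k l (g : Pairs P → Carrier) →
    sumL (pairs P) (λ b → δ ((k == proj₁ (proj₁ b)) ∧ (l == proj₂ (proj₁ b))) * g b) ≈ extend P g k l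
  sumL-pairs-at P k l g = begin
    _                                                                 ≈⟨ sumL-pairs-weighted P _ g ⟩
    sum (λ u → sum (λ v → δ ((k == u) ∧ (l == v)) * extend P g u v))  ≈⟨ ∑-cong (λ u → ∑-cong λ v → δ-∧-* (k == u) _ _) ⟩
    sum (λ u → sum (λ v → δ (k == u) * (δ (l == v) * extend P g u v))) ≈⟨ ∑-cong (λ u → sym (*-distribˡ-∑ _ _)) ⟩
    sum (λ u → δ (k == u) * sum (λ v → δ (l == v) * extend P g u v))   ≈⟨ ∑-cong (λ u → *-congˡ (∑-δˡ l _)) ⟩
    sum (λ u → δ (k == u) * extend P g u l)                            ≈⟨ ∑-δˡ k _ ⟩
    extend P g k l                                                     ∎

  sumL-pairs-from : ∀ P k (g : Pairs P → Carrier) →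
    sumL (pairs P) (λ b → δ (k == proj₁ (proj₁ b)) * g b) ≈ sum (extend P g k)
  sumL-pairs-from P k g = begin
    _                                                   ≈⟨ sumL-pairs-weighted P _ g ⟩
    sum (λ u → sum (λ v → δ (k == u) * extend P g u v)) ≈⟨ ∑-cong (λ u → sym (*-distribˡ-∑ _ _)) ⟩
    sum (λ u → δ (k == u) * sum (extend P g u))         ≈⟨ ∑-δˡ k _ ⟩
    sum (extend P g k)                                  ∎

  sumL-pairs-to : ∀ P l (g : Pairs P → Carrier) →
    sumL (pairs P) (λ b → δ (l == proj₂ (proj₁ b)) * g b) ≈ sum (λ u → extend P g u l)
  sumL-pairs-to P l g = trans (sumL-pairs-weighted P _ g) (∑-cong λ u → ∑-δˡ l _)

  rev : Arc → Arc
  rev a = (hd a , tl a) , ≡.subst T (adj-sym (tl a) (hd a)) (proj₂ a)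

  arc-≡ : ∀ {a b : Arc} → tl a ≡ tl b → hd a ≡ hd b → a ≡ b
  arc-≡ {(u , v) , t} {(.u , .v) , t′} ≡.refl ≡.refl = ≡.cong ((u , v) ,_) (Bool.T-irrelevant t t′)

  rev-involutive : ∀ a → rev (rev a) ≡ a
  rev-involutive a = arc-≡ ≡.refl ≡.refl

  adj⇒≢ : ∀ {u v} → T (adj u v) → u ≢ v
  adj⇒≢ {u} t ≡.refl = ≡.subst T (adj-irrefl u) t

  I-apply : ∀ (x : Arc → Carrier) a → app arcs I x a ≈ x a
  I-apply x a = trans (sumL-pairs-at adj (tl a) (hd a) x) (guard-true _ (proj₂ a))

  R-apply : ∀ (x : Arc → Carrier) a → app arcs R x a ≈ x (rev a)
  R-apply x a = begin
    sumL arcs (λ b → δ ((tl a == hd b) ∧ (hd a == tl b)) * x b) ≈⟨ sumL-cong arcs swap ⟩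
    sumL arcs (λ b → δ ((hd a == tl b) ∧ (tl a == hd b)) * x b) ≈⟨ sumL-pairs-at adj (hd a) (tl a) x ⟩
    extend adj x (hd a) (tl a)                                  ≈⟨ guard-true _ (proj₂ (rev a)) ⟩
    x (rev a)                                                   ∎
    where
    swap : ∀ b → δ ((tl a == hd b) ∧ (hd a == tl b)) * x b ≈ δ ((hd a == tl b) ∧ (tl a == hd b)) * x b
    swap b = *-congʳ (δ-≡ (Bool.∧-comm (tl a == hd b) _))

  I+R-apply : ∀ (x : Arc → Carrier) a → app arcs I+R x a ≈ x a + 1# * x (rev a)
  I+R-apply x a = begin
    sumL arcs (λ b → (I a b + R a b) * x b)         ≈⟨ sumL-cong arcs (λ b → distribʳ (x b) (I a b) (R a b)) ⟩
    sumL arcs (λ b → I a b * x b + R a b * x b)     ≈⟨ sumL-+ arcs _ _ ⟩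
    app arcs I x a + app arcs R x a                 ≈⟨ +-cong (I-apply x a) (trans (R-apply x a) (sym (*-identityˡ _))) ⟩
    x a + 1# * x (rev a)                            ∎

  I-R-apply : ∀ (x : Arc → Carrier) a → app arcs I-R x a ≈ x a + - 1# * x (rev a)
  I-R-apply x a = begin
    sumL arcs (λ b → (I a b - R a b) * x b)               ≈⟨ sumL-cong arcs split ⟩
    sumL arcs (λ b → I a b * x b + - 1# * (R a b * x b))  ≈⟨ sumL-+ arcs _ _ ⟩
    app arcs I x a + sumL arcs (λ b → - 1# * (R a b * x b)) ≈⟨ +-cong (I-apply x a) (sumL-*ˡ arcs (- 1#) _) ⟩
    x a + - 1# * app arcs R x a                           ≈⟨ +-congˡ (*-congˡ (R-apply x a)) ⟩
    x a + - 1# * x (rev a)                                ∎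
    where
    split : ∀ b → (I a b - R a b) * x b ≈ I a b * x b + - 1# * (R a b * x b)
    split b = trans (distribʳ (x b) (I a b) (- R a b))
                    (+-congˡ (trans (sym (-‿distribˡ-* (R a b) (x b))) (sym (-1*x≈-x _))))

  -- masked f = O_S f and outSum y = D_t y
  masked : (Fin n → Carrier) → Fin n → Carrier
  masked f u = δ (not (inS u)) * f u

  outSum : (Arc → Carrier) → Fin n → Carrier
  outSum y u = sum (extend adj y u)

  OSDt-entry : ∀ x a → OSDt x a ≈ δ (not (inS x)) * δ (x == tl a)
  OSDt-entry x a = begin
    sumL vertices (λ w → δ ((x == w) ∧ not (inS x)) * δ (w == tl a))  ≡⟨ sumL-allFin n _ ⟩
    sum (λ w → δ ((x == w) ∧ not (inS x)) * δ (w == tl a))            ≈⟨ ∑-cong (λ w → δ-∧-* (x == w) _ _) ⟩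
    sum (λ w → δ (x == w) * (δ (not (inS x)) * δ (w == tl a)))        ≈⟨ ∑-δˡ x _ ⟩
    δ (not (inS x)) * δ (x == tl a)                                   ∎

  OSDt-apply : ∀ (y : Arc → Carrier) x → app arcs OSDt y x ≈ masked (outSum y) x
  OSDt-apply y x = begin
    sumL arcs (λ a → OSDt x a * y a)                           ≈⟨ sumL-cong arcs entry ⟩
    sumL arcs (λ a → δ (not (inS x)) * (δ (x == tl a) * y a))  ≈⟨ sumL-*ˡ arcs _ _ ⟩
    δ (not (inS x)) * sumL arcs (λ a → δ (x == tl a) * y a)    ≈⟨ *-congˡ (sumL-pairs-from adj x y) ⟩
    masked (outSum y) x                                        ∎
    where
    entry : ∀ a → OSDt x a * y a ≈ δ (not (inS x)) * (δ (x == tl a) * y a)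
    entry a = trans (*-congʳ (OSDt-entry x a)) (*-assoc _ _ _)

  DtᵀOS-entry : ∀ a j → DtᵀOS a j ≈ δ ((tl a == j) ∧ not (inS (tl a)))
  DtᵀOS-entry a j = begin
    sumL vertices (λ w → δ (w == tl a) * δ ((w == j) ∧ not (inS w)))  ≡⟨ sumL-allFin n _ ⟩
    sum (λ w → δ (w == tl a) * δ ((w == j) ∧ not (inS w)))            ≈⟨ ∑-δʳ (tl a) _ ⟩
    δ ((tl a == j) ∧ not (inS (tl a)))                                ∎

  DtᵀOS-apply : ∀ (f : Fin n → Carrier) a → app vertices DtᵀOS f a ≈ masked f (tl a)
  DtᵀOS-apply f a = begin
    sumL vertices (λ j → DtᵀOS a j * f j)                    ≡⟨ sumL-allFin n _ ⟩
    sum (λ j → DtᵀOS a j * f j)                              ≈⟨ ∑-cong entry ⟩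
    sum (λ j → δ (tl a == j) * (δ (not (inS (tl a))) * f j)) ≈⟨ ∑-δˡ (tl a) _ ⟩
    masked f (tl a)                                          ∎
    where
    entry : ∀ j → DtᵀOS a j * f j ≈ δ (tl a == j) * (δ (not (inS (tl a))) * f j)
    entry j = trans (*-congʳ (DtᵀOS-entry a j)) (δ-∧-* (tl a == j) _ _)

  inS-∈ : ∀ {x} → x ∈ S → inS x ≡ true
  inS-∈ {x} x∈S = ≡.trans (isYes≗does (x ∈? S)) (dec-true (x ∈? S) x∈S)

  inS-∉ : ∀ {x} → x ∉ S → inS x ≡ false
  inS-∉ {x} x∉S = ≡.trans (isYes≗does (x ∈? S)) (dec-false (x ∈? S) x∉S)

  masked-∈ : ∀ f {x} → x ∈ S → masked f x ≈ 0#
  masked-∈ f x∈S = trans (*-congʳ (δ-≡ (≡.cong not (inS-∈ x∈S)))) (zeroˡ _)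

  masked-∉ : ∀ f {x} → x ∉ S → masked f x ≈ f x
  masked-∉ f x∉S = trans (*-congʳ (δ-≡ (≡.cong not (inS-∉ x∉S)))) (*-identityˡ _)

  masked-≈ : ∀ f {x} → (x ∈ S → f x ≈ 0#) → masked f x ≈ f x
  masked-≈ f {x} f-vanishes = by-cases (x ∈? S)
    where
    by-cases : Dec (x ∈ S) → masked f x ≈ f x
    by-cases (yes x∈S) = trans (masked-∈ f x∈S) (sym (f-vanishes x∈S))
    by-cases (no  x∉S) = masked-∉ f x∉S

  masked-zero : ∀ f {x} → (x ∉ S → f x ≈ 0#) → masked f x ≈ 0#
  masked-zero f {x} f-vanishes = by-cases (x ∈? S)
    where
    by-cases : Dec (x ∈ S) → masked f x ≈ 0#
    by-cases (yes x∈S) = masked-∈ f x∈S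
    by-cases (no  x∉S) = trans (masked-∉ f x∉S) (f-vanishes x∉S)

  ==-disjoint : ∀ x {u v} → u ≢ v → T (x == u) → T (x == v) → ⊥
  ==-disjoint x u≢v x≡u x≡v = u≢v (≡.trans (≡.sym (toWitness x≡u)) (toWitness x≡v))

  ==-∧-disjoint : ∀ x y {u v} → u ≢ v → T ((x == u) ∧ (y == v)) → T ((x == v) ∧ (y == u)) → ⊥
  ==-∧-disjoint x y {u} {v} u≢v p q =
    ==-disjoint x u≢v (proj₁ (Equivalence.to (Bool.T-∧ {x == u} {y == v}) p))
                    (proj₁ (Equivalence.to (Bool.T-∧ {x == v} {y == u}) q))

  edge-adj : ∀ {u v} → T (isEdge u v) → T (adj u v)
  edge-adj t = proj₁ (Equivalence.to Bool.T-∧ t)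

  end₁≢end₂ : ∀ (e : Edge) → end₁ e ≢ end₂ e
  end₁≢end₂ e = adj⇒≢ (edge-adj (proj₂ e))

  arcOf : Edge → Arc
  arcOf ((u , v) , t) = (u , v) , edge-adj t

  onPairs : Carrier → (Edge → Carrier) → Fin n → Fin n → Carrier
  onPairs ε w u v = extend isEdge w u v + ε * extend isEdge w v u

  onPairs-cong : ∀ ε {w w′ : Edge → Carrier} → (∀ e → w e ≈ w′ e) → ∀ u v → onPairs ε w u v ≈ onPairs ε w′ u v
  onPairs-cong ε w≈w′ u v = +-cong (guard-cong (isEdge u v) (λ t → w≈w′ ((u , v) , t)))
                                   (*-congˡ (guard-cong (isEdge v u) (λ t → w≈w′ ((v , u) , t))))

  arc-edge-apply : ∀ ε (A : Matrix Arc Edge) (z w : Edge → Carrier) a →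
    (∀ e → A a e * z e ≈ δ ((tl a == end₁ e) ∧ (hd a == end₂ e)) * w e
                         + ε * (δ ((tl a == end₂ e) ∧ (hd a == end₁ e)) * w e)) →
    app edges A z a ≈ onPairs ε w (tl a) (hd a)
  arc-edge-apply ε A z w a entry = begin
    sumL edges (λ e → A a e * z e)                                  ≈⟨ sumL-cong edges entry′ ⟩
    sumL edges (λ e → δ (to-arc e) * w e + ε * (δ (from-arc e) * w e)) ≈⟨ sumL-+ edges _ _ ⟩
    _ + sumL edges (λ e → ε * (δ (from-arc e) * w e))               ≈⟨ +-congˡ (sumL-*ˡ edges ε _) ⟩
    _ + ε * sumL edges (λ e → δ (from-arc e) * w e)                 ≈⟨ +-cong (sumL-pairs-at isEdge (tl a) (hd a) w)
                                                                              (*-congˡ (sumL-pairs-at isEdge (hd a) (tl a) w)) ⟩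
    onPairs ε w (tl a) (hd a)                                       ∎
    where
    to-arc from-arc : Edge → Bool
    to-arc   e = (tl a == end₁ e) ∧ (hd a == end₂ e)
    from-arc e = (hd a == end₁ e) ∧ (tl a == end₂ e)
    entry′ : ∀ e → A a e * z e ≈ δ (to-arc e) * w e + ε * (δ (from-arc e) * w e)
    entry′ e = trans (entry e) (+-congˡ (*-congˡ (*-congʳ (δ-≡ (Bool.∧-comm (tl a == end₂ e) _)))))

  vertex-edge-apply : ∀ ε (A : Matrix (Fin n) Edge) (z w : Edge → Carrier) x →
    (∀ e → A x e * z e ≈ δ (x == end₁ e) * w e + ε * (δ (x == end₂ e) * w e)) →
    app edges A z x ≈ sum (onPairs ε w x)
  vertex-edge-apply ε A z w x entry = begin
    sumL edges (λ e → A x e * z e)                                          ≈⟨ sumL-cong edges entry ⟩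
    sumL edges (λ e → δ (x == end₁ e) * w e + ε * (δ (x == end₂ e) * w e))  ≈⟨ sumL-+ edges _ _ ⟩
    _ + sumL edges (λ e → ε * (δ (x == end₂ e) * w e))                      ≈⟨ +-congˡ (sumL-*ˡ edges ε _) ⟩
    _ + ε * sumL edges (λ e → δ (x == end₂ e) * w e)                        ≈⟨ +-cong (sumL-pairs-from isEdge x w)
                                                                                      (*-congˡ (sumL-pairs-to isEdge x w)) ⟩
    sum (extend isEdge w x) + ε * sum (λ v → extend isEdge w v x)           ≈⟨ +-congˡ (*-distribˡ-∑ ε _) ⟩
    sum (extend isEdge w x) + sum (λ v → ε * extend isEdge w v x)           ≈⟨ ∑-distrib-+ {n} _ _ ⟨
    sum (onPairs ε w x)                                                     ∎

  oriented-entry : ∀ (φ : Fin n → Fin n → Bool) b u v → (T (φ u v) → T (φ v u) → ⊥) → ∀ x →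
    (if φ (if b then u else v) (if b then v else u) then 1#
     else (if φ (if b then v else u) (if b then u else v) then - 1# else 0#)) * x
      ≈ δ (φ u v) * (sign b * x) + - 1# * (δ (φ v u) * (sign b * x))
  oriented-entry φ true u v disjoint x =
    trans (δ-ite-* _ _ disjoint x) (sym (+-cong (*-congˡ (*-identityˡ x)) (*-congˡ (*-congˡ (*-identityˡ x)))))
  oriented-entry φ false u v disjoint x = begin
    _                                                          ≈⟨ δ-ite-* _ _ (λ p q → disjoint q p) x ⟩
    δ (φ v u) * x + - 1# * (δ (φ u v) * x)                     ≈⟨ +-comm _ _ ⟩
    - 1# * (δ (φ u v) * x) + δ (φ v u) * x                     ≈⟨ +-cong (sym (x*[y*z]≈y*[x*z] _ _ x))
                                                                         (sym (trans (*-congˡ (x*[y*z]≈y*[x*z] _ _ x)) (-1*[-1*x]≈x _))) ⟩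
    δ (φ u v) * (- 1# * x) + - 1# * (δ (φ v u) * (- 1# * x))   ∎

  oriented : Orientation → (Edge → Carrier) → Edge → Carrier
  oriented o z e = sign (o e) * z e

  oriented-involutive : ∀ o z e → oriented o (oriented o z) e ≈ z e
  oriented-involutive o z e = trans (sym (*-assoc _ _ _)) (trans (*-congʳ (sign*sign (o e))) (*-identityˡ _))

  M-apply : ∀ z a → app edges M z a ≈ onPairs 1# z (tl a) (hd a)
  M-apply z a = arc-edge-apply 1# M z z a λ e → δ-∨-* _ _ (==-∧-disjoint (tl a) (hd a) (end₁≢end₂ e)) (z e)

  B-apply : ∀ z x → app edges B z x ≈ sum (onPairs 1# z x)
  B-apply z x = vertex-edge-apply 1# B z z x λ e → δ-∨-* _ _ (==-disjoint x (end₁≢end₂ e)) (z e)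

  N-apply : ∀ o z a → app edges (N o) z a ≈ onPairs (- 1#) (oriented o z) (tl a) (hd a)
  N-apply o z a = arc-edge-apply (- 1#) (N o) z (oriented o z) a λ e →
    oriented-entry (λ s t → (tl a == s) ∧ (hd a == t)) (o e) (end₁ e) (end₂ e)
                   (==-∧-disjoint (tl a) (hd a) (end₁≢end₂ e)) (z e)

  C-apply : ∀ o z x → app edges (C o) z x ≈ sum (onPairs (- 1#) (oriented o z) x)
  C-apply o z x = vertex-edge-apply (- 1#) (C o) z (oriented o z) x λ e →
    oriented-entry (λ s t → x == s) (o e) (end₁ e) (end₂ e) (==-disjoint x (end₁≢end₂ e)) (z e)

  -- ε-symmetric arc vectors

  isEdge-< : ∀ {u v} → T (adj u v) → toℕ u < toℕ v → T (isEdge u v)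
  isEdge-< t u<v = Equivalence.from Bool.T-∧ (t , ℕ.<⇒<ᵇ u<v)

  isEdge-≮ : ∀ {u v} → ¬ (toℕ u < toℕ v) → isEdge u v ≡ false
  isEdge-≮ {u} {v} u≮v = ≡.trans (≡.cong (adj u v ∧_) (<ᵇ-false _ _ u≮v)) (Bool.∧-zeroʳ (adj u v))

  isEdge-¬adj : ∀ {u v} → adj u v ≡ false → isEdge u v ≡ false
  isEdge-¬adj u≁v = ≡.cong (_∧ _) u≁v

  Symmetric : Carrier → (Arc → Carrier) → Set ℓ
  Symmetric ε y = ∀ a → y (rev a) ≈ ε * y a

  onPairs-symmetric : ∀ {ε} → ε * ε ≈ 1# → ∀ w u v → onPairs ε w v u ≈ ε * onPairs ε w u v
  onPairs-symmetric ε²≈1 w u v = ε-swap ε²≈1 _ _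

  onPairs-restrict : ∀ {ε} → ε * ε ≈ 1# → ∀ {y} → Symmetric ε y → ∀ a → onPairs ε (y ∘ arcOf) (tl a) (hd a) ≈ y a
  onPairs-restrict {ε} ε²≈1 {y} y-sym a@((u , v) , u~v) with Fin.<-cmp u v
  ... | tri< u<v _ v≮u = begin
    extend isEdge (y ∘ arcOf) u v + ε * extend isEdge (y ∘ arcOf) v u ≈⟨ +-cong (guard-true _ (isEdge-< u~v u<v))
                                                                             (*-congˡ (guard-false _ (isEdge-≮ v≮u))) ⟩
    y (arcOf ((u , v) , _)) + ε * 0#                                   ≈⟨ +-congˡ (zeroʳ ε) ⟩
    y (arcOf ((u , v) , _)) + 0#                                       ≈⟨ +-identityʳ _ ⟩
    y (arcOf ((u , v) , isEdge-< u~v u<v))                             ≡⟨ ≡.cong y (arc-≡ ≡.refl ≡.refl) ⟩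
    y a                                                                ∎
  ... | tri≈ _ u≡v _ = ⊥-elim (adj⇒≢ u~v u≡v)
  ... | tri> u≮v _ v<u = begin
    extend isEdge (y ∘ arcOf) u v + ε * extend isEdge (y ∘ arcOf) v u ≈⟨ +-cong (guard-false _ (isEdge-≮ u≮v))
                                                                             (*-congˡ (guard-true _ (isEdge-< v~u v<u))) ⟩
    0# + ε * y (arcOf ((v , u) , _))                                   ≈⟨ +-identityˡ _ ⟩
    ε * y (arcOf ((v , u) , isEdge-< v~u v<u))                         ≡⟨ ≡.cong (λ b → ε * y b) (arc-≡ ≡.refl ≡.refl) ⟩
    ε * y (rev a)                                                      ≈⟨ *-congˡ (y-sym a) ⟩
    ε * (ε * y a)                                                      ≈⟨ ε*[ε*x]≈x ε²≈1 (y a) ⟩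
    y a                                                                ∎
    where
    v~u : T (adj v u)
    v~u = proj₂ (rev a)

  outSum-onPairs : ∀ ε w {y} → (∀ a → y a ≈ onPairs ε w (tl a) (hd a)) → ∀ x → outSum y x ≈ sum (onPairs ε w x)
  outSum-onPairs ε w y≈ x = ∑-cong λ v → guard-≈ (adj x v) (λ t → y≈ ((x , v) , t)) (onPairs-¬adj v)
    where
    onPairs-¬adj : ∀ v → adj x v ≡ false → onPairs ε w x v ≈ 0#
    onPairs-¬adj v x≁v = begin
      extend isEdge w x v + ε * extend isEdge w v x ≈⟨ +-cong (guard-false _ (isEdge-¬adj x≁v))
                                                             (*-congˡ (guard-false _ (isEdge-¬adj (≡.trans (adj-sym v x) x≁v)))) ⟩
      0# + ε * 0#                                   ≈⟨ +-identityˡ _ ⟩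
      ε * 0#                                        ≈⟨ zeroʳ ε ⟩
      0#                                            ∎

  -- Twisted-constant vertex functions

  TwistedConstant : Carrier → (Fin n → Carrier) → Set ℓ
  TwistedConstant ε f = ∀ {u v} → T (adj u v) → f v ≈ ε * f u

  walk-transport : ∀ {p} (P : Fin n → Set p) → (∀ {u v} → T (adj u v) → P u → P v) → ∀ {u v} → Walk u v → P u → P v
  walk-transport P step-P here        Pu = Pu
  walk-transport P step-P (step t w)  Pu = walk-transport P step-P w (step-P t Pu)

  parity : ∀ {u v} → Walk u v → Bool
  parity here       = true
  parity (step _ w) = not (parity w)

  twisted-walk : ∀ {f} → TwistedConstant (- 1#) f → ∀ {u v} (w : Walk u v) → f u ≈ sign (parity w) * f v
  twisted-walk f-twisted here = sym (*-identityˡ _)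
  twisted-walk {f} f-twisted (step {u} {u′} {v} t w) = begin
    f u                               ≈⟨ -1*[-1*x]≈x (f u) ⟨
    - 1# * (- 1# * f u)               ≈⟨ *-congˡ (f-twisted t) ⟨
    - 1# * f u′                       ≈⟨ *-congˡ (twisted-walk f-twisted w) ⟩
    - 1# * (sign (parity w) * f v)    ≈⟨ *-assoc _ _ _ ⟨
    (- 1# * sign (parity w)) * f v    ≈⟨ *-congʳ (sign-not (parity w)) ⟩
    sign (not (parity w)) * f v       ∎

  ¬bipartition⇒monochromatic-edge : ∀ col → ¬ Bipartition col →
                                   Σ (Fin n) λ u → Σ (Fin n) λ v → T (adj u v) × col u ≡ col v
  ¬bipartition⇒monochromatic-edge col not-proper =
    u , v , decidable-stable (T? (adj u v)) (λ u≁v → not-proper-at (⊥-elim ∘ u≁v))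
          , decidable-stable (col u Bool.≟ col v) (λ u≢v → not-proper-at (λ _ → u≢v))
    where
    proper-at? : ∀ u v → Dec (T (adj u v) → col u ≢ col v)
    proper-at? u v = T? (adj u v) →-dec ¬? (col u Bool.≟ col v)
    improper-vertex : Σ (Fin n) λ u → ¬ (∀ v → T (adj u v) → col u ≢ col v)
    improper-vertex = Fin.¬∀⟶∃¬ n _ (λ u → Fin.all? (proper-at? u)) not-proper
    u : Fin n
    u = proj₁ improper-vertex
    improper-edge : Σ (Fin n) λ v → ¬ (T (adj u v) → col u ≢ col v)
    improper-edge = Fin.¬∀⟶∃¬ n _ (proper-at? u) (proj₂ improper-vertex)
    v : Fin n
    v = proj₁ improper-edge
    not-proper-at : ¬ (T (adj u v) → col u ≢ col v)
    not-proper-at = proj₂ improper-edge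

  module _ (connected : Connected) where

    twisted-vanishing : ∀ {ε f} → TwistedConstant ε f → ∀ {s} → f s ≈ 0# → ∀ u → f u ≈ 0#
    twisted-vanishing {ε} {f} f-twisted {s} fs≈0 u =
      walk-transport (λ v → f v ≈ 0#) (λ t fu≈0 → trans (f-twisted t) (trans (*-congˡ fu≈0) (zeroʳ ε))) (connected s u) fs≈0

    S≢∅⇒twisted-vanishing : ¬ S ≡ ∅ → ∀ {ε f} → TwistedConstant ε f →
                            (∀ {s} → s ∈ S → f s ≈ 0#) → ∀ u → f u ≈ 0#
    S≢∅⇒twisted-vanishing S≢∅ f-twisted f-vanishes =
      twisted-vanishing f-twisted (f-vanishes (proj₂ member))
      where
      member : Σ (Fin n) (_∈ S)
      member = decidable-stable (nonempty? S) (λ S-empty → S≢∅ (Empty-unique S-empty))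

    locally-constant : ∀ {g : Fin n → Carrier} → (∀ {u v} → T (adj u v) → g v ≈ g u) → ∀ u v → g u ≈ g v
    locally-constant {g} g-step u v =
      walk-transport (λ w → g u ≈ g w) (λ t gu≈gw → trans gu≈gw (sym (g-step t))) (connected u v) refl

    twisted-one : ∀ {f} → TwistedConstant 1# f → Σ Carrier λ t → ∀ u → f u ≈ t * 1#
    twisted-one {f} f-twisted
      with pairwise-≈⇒constant f (locally-constant (λ t → trans (f-twisted t) (*-identityˡ _)))
    ... | t , f≈t = t , λ u → trans (f≈t u) (sym (*-identityʳ t))

    twisted-bipartite : ∀ {col} → Bipartition col → ∀ {f} → TwistedConstant (- 1#) f →
                        Σ Carrier λ t → ∀ u → f u ≈ t * sign (col u)
    twisted-bipartite {col} col-proper {f} f-twisted with pairwise-≈⇒constant g (locally-constant g-step)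
      where
      g : Fin n → Carrier
      g u = sign (col u) * f u
      g-step : ∀ {u v} → T (adj u v) → g v ≈ g u
      g-step {u} {v} t = trans (*-cong (sign-≢ (col-proper u v t)) (f-twisted t)) ([-1*x]*[-1*y]≈x*y _ _)
    ... | t , g≈t = t , λ u → begin
      f u                                  ≈⟨ ε*[ε*x]≈x (sign*sign (col u)) (f u) ⟨
      sign (col u) * (sign (col u) * f u)  ≈⟨ *-congˡ (g≈t u) ⟩
      sign (col u) * t                     ≈⟨ *-comm _ _ ⟩
      t * sign (col u)                     ∎

    parity-colouring : Fin n → Fin n → Bool
    parity-colouring r u = parity (connected u r)

    -- On an edge that the parity colouring towards r fails to separate, f changes sign but
    -- takes the same value ±f r at both ends, so f r = - f r.
    twisted-non-bipartite : ¬ (1# + 1# ≈ 0#) → ¬ Bipartite → ∀ {f} → TwistedConstant (- 1#) f → ∀ r → f r ≈ 0#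
    twisted-non-bipartite 1+1≉0 not-bipartite {f} f-twisted r
      with ¬bipartition⇒monochromatic-edge (parity-colouring r) (λ proper → not-bipartite (_ , proper))
    ... | u , v , u~v , same = begin
      f r            ≈⟨ ε*[ε*x]≈x (sign*sign (parity-colouring r u)) (f r) ⟨
      s * (s * f r)  ≈⟨ *-congˡ (x≈-1*x⇒x≈0 s*fr≈-s*fr) ⟩
      s * 0#         ≈⟨ zeroʳ s ⟩
      0#             ∎
      where
      open CharacteristicNotTwo 1+1≉0
      s : Carrier
      s = sign (parity-colouring r u)
      s*fr≈-s*fr : s * f r ≈ - 1# * (s * f r)
      s*fr≈-s*fr = begin
        s * f r                                ≡⟨ ≡.cong (λ b → sign b * f r) same ⟩
        sign (parity-colouring r v) * f r      ≈⟨ twisted-walk f-twisted (connected v r) ⟨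
        f v                                    ≈⟨ f-twisted u~v ⟩
        - 1# * f u                             ≈⟨ *-congˡ (twisted-walk f-twisted (connected u r)) ⟩
        - 1# * (s * f r)                       ∎

  -- The four intersections

  module IεR (ε : Carrier) (ε²≈1 : ε * ε ≈ 1#) (A : Matrix Arc Arc)
              (A-apply : ∀ x a → app arcs A x a ≈ x a + ε * x (rev a)) where

    col⇒symmetric : ∀ {y} → Col arcs A y → Symmetric ε y
    col⇒symmetric {y} (x , Ax≈y) a = begin
      y (rev a)                        ≈⟨ Ax≈y (rev a) ⟨
      app arcs A x (rev a)             ≈⟨ A-apply x (rev a) ⟩
      x (rev a) + ε * x (rev (rev a))  ≡⟨ ≡.cong (λ b → x (rev a) + ε * x b) (rev-involutive a) ⟩
      x (rev a) + ε * x a              ≈⟨ ε-swap ε²≈1 (x a) (x (rev a)) ⟩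
      ε * (x a + ε * x (rev a))        ≈⟨ *-congˡ (trans (sym (A-apply x a)) (Ax≈y a)) ⟩
      ε * y a                          ∎

    module _ (1+1≉0 : ¬ (1# + 1# ≈ 0#)) where
      open CharacteristicNotTwo 1+1≉0

      symmetric⇒col : ∀ {y} → Symmetric ε y → Col arcs A y
      symmetric⇒col {y} y-sym = (λ a → half * y a) , λ a → begin
        app arcs A (λ b → half * y b) a       ≈⟨ A-apply _ a ⟩
        half * y a + ε * (half * y (rev a))   ≈⟨ +-congˡ (*-congˡ (*-congˡ (y-sym a))) ⟩
        half * y a + ε * (half * (ε * y a))   ≈⟨ +-congˡ (x*[y*z]≈y*[x*z] ε half _) ⟩
        half * y a + half * (ε * (ε * y a))   ≈⟨ +-congˡ (*-congˡ (ε*[ε*x]≈x ε²≈1 (y a))) ⟩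
        half * y a + half * y a               ≈⟨ half+half (y a) ⟩
        y a                                   ∎

      col∩ker≐img : ∀ (Q : Matrix Arc Edge) (P : Matrix (Fin n) Edge) (W : (Edge → Carrier) → Edge → Carrier) →
        (∀ z a → app edges Q z a ≈ onPairs ε (W z) (tl a) (hd a)) →
        (∀ z x → app edges P z x ≈ sum (onPairs ε (W z) x)) →
        (∀ w → Σ (Edge → Carrier) λ z → ∀ e → W z e ≈ w e) →
        (Col arcs A ∩ Ker arcs OSDt) ≐ Img edges Q (Ker edges (rows Sbar P))
      col∩ker≐img Q P W Q-apply P-apply W-onto y = forward , backward
        where
        forward : (Col arcs A ∩ Ker arcs OSDt) y → Img edges Q (Ker edges (rows Sbar P)) y
        forward (y-col , lift y-ker) = z , lift z-ker , λ a → trans (Q-apply z a) (sym (y≈ a))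
          where
          z : Edge → Carrier
          z = proj₁ (W-onto (y ∘ arcOf))
          y≈ : ∀ a → y a ≈ onPairs ε (W z) (tl a) (hd a)
          y≈ a = trans (sym (onPairs-restrict ε²≈1 (col⇒symmetric y-col) a))
                       (onPairs-cong ε (λ e → sym (proj₂ (W-onto (y ∘ arcOf)) e)) _ _)
          z-ker : ∀ x → app edges (rows Sbar P) z x ≈ 0#
          z-ker (x , x∉S) = begin
            app edges P z x             ≈⟨ P-apply z x ⟩
            sum (onPairs ε (W z) x)     ≈⟨ outSum-onPairs ε (W z) y≈ x ⟨
            outSum y x                     ≈⟨ masked-∉ (outSum y) x∉S ⟨
            masked (outSum y) x            ≈⟨ OSDt-apply y x ⟨
            app arcs OSDt y x           ≈⟨ y-ker x ⟩
            0#                          ∎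
        backward : Img edges Q (Ker edges (rows Sbar P)) y → (Col arcs A ∩ Ker arcs OSDt) y
        backward (z , lift z-ker , Qz≈y) = symmetric⇒col y-sym , lift y-ker
          where
          y≈ : ∀ a → y a ≈ onPairs ε (W z) (tl a) (hd a)
          y≈ a = trans (sym (Qz≈y a)) (Q-apply z a)
          y-sym : Symmetric ε y
          y-sym a = trans (y≈ (rev a)) (trans (onPairs-symmetric ε²≈1 (W z) _ _) (*-congˡ (sym (y≈ a))))
          y-ker : ∀ x → app arcs OSDt y x ≈ 0#
          y-ker x = trans (OSDt-apply y x) (masked-zero (outSum y) λ x∉S →
            trans (outSum-onPairs ε (W z) y≈ x) (trans (sym (P-apply z x)) (z-ker (x , x∉S))))

      col∩col⇒tail : ∀ {y} → (Col arcs A ∩ Col vertices DtᵀOS) y →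
        Σ (Fin n → Carrier) λ f → TwistedConstant ε f × (∀ {s} → s ∈ S → f s ≈ 0#) × (∀ a → y a ≈ f (tl a))
      col∩col⇒tail {y} (y-col , x , DtᵀOSx≈y) = masked x , f-twisted , masked-∈ x , y≈
        where
        y≈ : ∀ a → y a ≈ masked x (tl a)
        y≈ a = trans (sym (DtᵀOSx≈y a)) (DtᵀOS-apply x a)
        f-twisted : TwistedConstant ε (masked x)
        f-twisted t = trans (sym (y≈ (rev (_ , t)))) (trans (col⇒symmetric y-col (_ , t)) (*-congˡ (y≈ (_ , t))))

      tail⇒col∩col : ∀ {y} f → TwistedConstant ε f → (∀ {s} → s ∈ S → f s ≈ 0#) → (∀ a → y a ≈ f (tl a)) →
        (Col arcs A ∩ Col vertices DtᵀOS) y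
      tail⇒col∩col {y} f f-twisted f-vanishes y≈ =
        symmetric⇒col y-sym , f , λ a → trans (DtᵀOS-apply f a) (trans (masked-≈ f f-vanishes) (sym (y≈ a)))
        where
        y-sym : Symmetric ε y
        y-sym a = trans (y≈ (rev a)) (trans (f-twisted (proj₂ a)) (*-congˡ (sym (y≈ a))))

      col∩col≐zero : (∀ {f} → TwistedConstant ε f → (∀ {s} → s ∈ S → f s ≈ 0#) → ∀ u → f u ≈ 0#) →
        (Col arcs A ∩ Col vertices DtᵀOS) ≐ zeroSpace
      col∩col≐zero only-zero y = forward , backward
        where
        forward : (Col arcs A ∩ Col vertices DtᵀOS) y → zeroSpace y
        forward y∈ with col∩col⇒tail y∈
        ... | f , f-twisted , f-vanishes , y≈ = lift λ a → trans (y≈ a) (only-zero f-twisted f-vanishes (tl a))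
        backward : zeroSpace y → (Col arcs A ∩ Col vertices DtᵀOS) y
        backward (lift y≈0) = tail⇒col∩col (λ _ → 0#) (λ _ → sym (zeroʳ ε)) (λ _ → refl) y≈0

      col∩col≐span : S ≡ ∅ → ∀ g → TwistedConstant ε g →
        (∀ {f} → TwistedConstant ε f → Σ Carrier λ t → ∀ u → f u ≈ t * g u) →
        (Col arcs A ∩ Col vertices DtᵀOS) ≐ span1 (g ∘ tl)
      col∩col≐span S≡∅ g g-twisted multiple-of-g y = forward , backward
        where
        forward : (Col arcs A ∩ Col vertices DtᵀOS) y → span1 (g ∘ tl) y
        forward y∈ with col∩col⇒tail y∈
        ... | f , f-twisted , _ , y≈ with multiple-of-g f-twisted
        ...   | t , f≈tg = t , λ a → trans (y≈ a) (f≈tg (tl a))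
        backward : span1 (g ∘ tl) y → (Col arcs A ∩ Col vertices DtᵀOS) y
        backward (t , y≈) = tail⇒col∩col (λ u → t * g u) tg-twisted nothing-in-S y≈
          where
          tg-twisted : TwistedConstant ε (λ u → t * g u)
          tg-twisted u~v = trans (*-congˡ (g-twisted u~v)) (x*[y*z]≈y*[x*z] t ε _)
          nothing-in-S : ∀ {s} → s ∈ S → t * g s ≈ 0#
          nothing-in-S s∈S = ⊥-elim (∉⊥ (≡.subst (_ ∈_) S≡∅ s∈S))

corollary2p2 : ∀ {c ℓ} (F : Field c ℓ) → CharZero F →
    ∀ {n} (X : Graph n) → GraphDefs.Connected X → (S : Subset n) →
    let open GraphMatrices F X S in
      ((Col arcs I+R ∩ Ker arcs OSDt) ≐ Img edges M (Ker edges B̄))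
    × (∀ (o : Orientation) → (Col arcs I-R ∩ Ker arcs OSDt) ≐ Img edges (N o) (Ker edges (C̄ o)))
    × ((S ≡ ∅ → (Col arcs I+R ∩ Col vertices DtᵀOS) ≐ span1 one)
       × (¬ (S ≡ ∅) → (Col arcs I+R ∩ Col vertices DtᵀOS) ≐ zeroSpace))
    × ((∀ (col : Fin n → Bool) → Bipartition col → S ≡ ∅ →
          (Col arcs I-R ∩ Col vertices DtᵀOS) ≐ span1 (ybip col))
       × ((¬ (S ≡ ∅) ⊎ ¬ Bipartite) → (Col arcs I-R ∩ Col vertices DtᵀOS) ≐ zeroSpace))
corollary2p2 F char-zero X connected S =
    Sym.col∩ker≐img 1+1≉0 M B (λ z → z) M-apply B-apply (λ w → w , λ _ → refl)
  , (λ o → Anti.col∩ker≐img 1+1≉0 (N o) (C o) (oriented o) (N-apply o) (C-apply o)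
                              (λ w → oriented o w , oriented-involutive o w))
  , ( (λ S≡∅ → Sym.col∩col≐span 1+1≉0 S≡∅ (λ _ → 1#) (λ _ → sym (*-identityˡ 1#)) (twisted-one connected))
    , (λ S≢∅ → Sym.col∩col≐zero 1+1≉0 (S≢∅⇒twisted-vanishing connected S≢∅)))
  , ( (λ col col-proper S≡∅ → Anti.col∩col≐span 1+1≉0 S≡∅ (sign ∘ col) (λ {u} {v} t → sign-≢ (col-proper u v t))
                                                  (twisted-bipartite connected col-proper))
    , λ { (inj₁ S≢∅)           → Anti.col∩col≐zero 1+1≉0 (S≢∅⇒twisted-vanishing connected S≢∅)
        ; (inj₂ not-bipartite) → Anti.col∩col≐zero 1+1≉0 (λ f-twisted _ →
                                     twisted-non-bipartite connected 1+1≉0 not-bipartite f-twisted) })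
  where
  open Field F hiding (zero)
  open Scalars F
  open Incidence F X S
  open GraphMatrices F X S using (I+R; I-R; M; B; N; C)
  module Sym  = IεR 1# (*-identityˡ 1#) I+R I+R-apply
  module Anti = IεR (- 1#) -1*-1≈1 I-R I-R-apply
  1+1≉0 : ¬ (1# + 1# ≈ 0#)
  1+1≉0 1+1≈0 = char-zero 1 (trans (+-congˡ (+-identityʳ 1#)) 1+1≈0)
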